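{- Let $a_{n,k}$ denote the number of dispersed Dyck paths of length $n$ having exactly $k$ 1-ascents, and let $f_0(z,t)=\sum_{n\ge0}\sum_{k\ge0}a_{n,k}z^nt^k$. Then \[ f_0(z,t)=\frac{ -1+2z-z^2+z^2t+W}{2z\,(z^2+1-2z-z^3+z^3t-z^2t)},\qquad W=\sqrt{1-2(t+1)z^2-(t+3)(1-t)z^4}. \] In particular, the generating function of dispersed Dyck paths with no 1-ascent is \[ f_0(z,0)=\frac{ -1+2z-z^2+\sqrt{1-2z^2-3z^4}}{2z(1-2z+z^2-z^3)}, \] and $f_0(z,1)=-\frac1{2z}+\frac{\sqrt{1-4z^2}}{2z(1-2z)}=\sum_{n\ge0}\binom{n}{\lfloor n/2\rfloor}z^n$.
   Context: A dispersed Dyck path of length $n$ is a sequence of $n$ steps, each an up-step $U=(1,1)$, a down-step $D=(1,-1)$, or a flat step $H=(1,0)$, starting at $(0,0)$, ending on the $x$-axis, never going below the $x$-axis, such that flat steps occur only on the $x$-axis (i.e. only as steps from $(k,0)$ to $(k+1,0)$). An ascent is a maximal run of consecutive $U$ steps; a 1-ascent is an ascent consisting of exactly one $U$ step. -}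

module Defs where

open import Data.Bool using (Bool; true; false; _∧_; if_then_else_)
open import Data.Nat as ℕ using (ℕ; zero; suc; _∸_; _≡ᵇ_)
open import Data.Integer as ℤ using (ℤ; +_; _+_; _*_; -_)
open import Data.List using (List; []; _∷_; map; concatMap; length; filterᵇ; foldr; upTo)

-- Steps of a lattice path: U = (1,1), D = (1,-1), H = (1,0).
data Step : Set where
  U D H : Step

words : ℕ → List (List Step)
words zero    = [] ∷ []
words (suc n) = concatMap (λ w → (U ∷ w) ∷ (D ∷ w) ∷ (H ∷ w) ∷ []) (words n)

validFrom : ℕ → List Step → Bool
validFrom zero    []      = true
validFrom (suc _) []      = false
validFrom h       (U ∷ w) = validFrom (suc h) w
validFrom zero    (D ∷ w) = false
validFrom (suc h) (D ∷ w) = validFrom h w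
validFrom zero    (H ∷ w) = validFrom zero w
validFrom (suc _) (H ∷ w) = false

isDispersedDyck : List Step → Bool
isDispersedDyck = validFrom zero

-- Number of 1-ascents (maximal runs of U of length exactly 1).
-- The Bool flag records whether the previous step was U.
oneAscFrom : Bool → List Step → ℕ
oneAscFrom _     []            = zero
oneAscFrom false (U ∷ U ∷ w)   = oneAscFrom true (U ∷ w)
oneAscFrom false (U ∷ w)       = suc (oneAscFrom true w)
oneAscFrom true  (U ∷ w)       = oneAscFrom true w
oneAscFrom _     (D ∷ w)       = oneAscFrom false w
oneAscFrom _     (H ∷ w)       = oneAscFrom false w

oneAscents : List Step → ℕ
oneAscents = oneAscFrom false

a : ℕ → ℕ → ℕ
a n k = length (filterᵇ (λ w → isDispersedDyck w ∧ (oneAscents w ≡ᵇ k)) (words n))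

numDispersed : ℕ → ℕ
numDispersed n = length (filterᵇ isDispersedDyck (words n))

-- Formal power series in z, t over ℤ: Ser assigns to (n , k) the
-- coefficient of z^n t^k.

Ser : Set
Ser = ℕ → ℕ → ℤ

sumℤ : List ℤ → ℤ
sumℤ = foldr _+_ (+ 0)

infixl 6 _⊕_ _⊖_
infixl 7 _⊗_

_⊕_ : Ser → Ser → Ser
(f ⊕ g) n k = f n k + g n k

_⊖_ : Ser → Ser → Ser
(f ⊖ g) n k = f n k + (- g n k)

_⊗_ : Ser → Ser → Ser
(f ⊗ g) n k =
  sumℤ (map (λ i → sumℤ (map (λ j → f i j * g (n ∸ i) (k ∸ j)) (upTo (suc k))))
            (upTo (suc n)))

mono : ℤ → ℕ → ℕ → Ser
mono c i j n k = if (n ≡ᵇ i) ∧ (k ≡ᵇ j) then c else + 0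

cst : ℤ → Ser
cst c = mono c 0 0

Z T : Ser
Z = mono (+ 1) 1 0
T = mono (+ 1) 0 1

f0 : Ser
f0 n k = + a n k

denomP : Ser
denomP = Z ⊗ Z ⊕ cst (+ 1) ⊖ cst (+ 2) ⊗ Z ⊖ Z ⊗ Z ⊗ Z ⊕ Z ⊗ Z ⊗ Z ⊗ T ⊖ Z ⊗ Z ⊗ T

numerN : Ser
numerN = cst (- + 1) ⊕ cst (+ 2) ⊗ Z ⊖ Z ⊗ Z ⊕ Z ⊗ Z ⊗ T

radicand : Ser
radicand = cst (+ 1) ⊖ cst (+ 2) ⊗ (T ⊕ cst (+ 1)) ⊗ Z ⊗ Z
             ⊖ (T ⊕ cst (+ 3)) ⊗ (cst (+ 1) ⊖ T) ⊗ Z ⊗ Z ⊗ Z ⊗ Z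

one two : Ser
one = cst (+ 1)
two = cst (+ 2)

{-# OPTIONS --safe #-}
-- Splitting a path after its first step gives, for each starting height h, a linear
-- system for the generating functions of paths from h, with a flag recording whether
-- the previous step was U so that completed 1-ascents can be marked by t.  With
-- B = z(yx + t) and the power series x, y, f determined by
--   y = z(1 + yx),   x = z(1 + Bx),   f = 1 + z(Bf + f),
-- the series x^h f, B x^h f and y x^h f solve that system; as the system determines
-- its solution coefficient by coefficient, f0 = f.  Eliminating y and x gives
-- z D f² = N f + 1 for the denominator D and numerator N of the statement, so
-- W = 2zDf - N satisfies W² = N² + 4zD, which is the radicand.  Forgetting t, the
-- paths of length n from height h number C(n, ⌈(h + n)/2⌉) by Pascal's rule.
module Submission where

open import Defs
open import Level using (0ℓ)
open import Algebra.Bundles using (CommutativeRing; RawRing)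
open import Algebra.Solver.Ring.AlmostCommutativeRing
  using (_-Raw-AlmostCommutative⟶_; fromCommutativeRing; -raw-almostCommutative⟶)
open import Data.Bool using (Bool; true; false; _∧_; if_then_else_)
open import Data.Bool.Properties using (∧-zeroʳ)
open import Data.Integer as ℤ using (ℤ; +_)
import Data.Integer.Properties as ℤ
import Data.Integer.Tactic.RingSolver as ℤ-Solver
open import Data.List using (List; []; _∷_; _++_; length; filterᵇ; concatMap; map; foldr; upTo; applyUpTo)
open import Data.List.Properties using (map-∘; map-cong; map-applyUpTo)
open import Data.Maybe using (just; nothing)
open import Data.Nat as ℕ using (ℕ; zero; suc; _∸_; _≤_; _<_; z≤n; s≤s; _≡ᵇ_; _/_; ⌊_/2⌋; ⌈_/2⌉)
import Data.Nat.Properties as ℕ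
open import Data.Nat.Combinatorics using (_C_; nCk≡nC[n∸k]; nCk+nC[k+1]≡[n+1]C[k+1])
open import Data.Nat.DivMod using (m/n≡1+[m∸n]/n)
open import Data.Nat.Tactic.RingSolver using (solve-∀)
open import Data.Product using (Σ; _×_; _,_)
open import Function using (_∘_)
open import Relation.Binary.Definitions using (WeaklyDecidable)
open import Relation.Binary.PropositionalEquality as ≡ using (_≡_)
open import Relation.Nullary using (yes; no)

module PowerSeries {c ℓ} (R : CommutativeRing c ℓ) where

  open CommutativeRing R
  open import Algebra.Properties.CommutativeSemigroup +-commutativeSemigroup using (interchange)
  open import Relation.Binary.Reasoning.Setoid setoid

  Series : Set c
  Series = ℕ → Carrier

  tail : Series → Series
  tail f = f ∘ suc

  infix  4 _≈ₛ_
  infixl 6 _+ₛ_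
  infixl 7 _*ₛ_ _·ₛ_

  _≈ₛ_ : Series → Series → Set ℓ
  f ≈ₛ g = ∀ n → f n ≈ g n

  _+ₛ_ : Series → Series → Series
  (f +ₛ g) n = f n + g n

  -ₛ_ : Series → Series
  (-ₛ f) n = - f n

  _·ₛ_ : Carrier → Series → Series
  (a ·ₛ f) n = a * f n

  const : Carrier → Series
  const a zero    = a
  const a (suc _) = 0#

  0ₛ 1ₛ X : Series
  0ₛ _ = 0#
  1ₛ = const 1#
  X zero    = 0#
  X (suc n) = 1ₛ n

  _*ₛ_ : Series → Series → Series
  (f *ₛ g) zero    = f 0 * g 0
  (f *ₛ g) (suc n) = f 0 * g (suc n) + (tail f *ₛ g) n

  *ₛ-cong : ∀ {f f′ g g′} → f ≈ₛ f′ → g ≈ₛ g′ → f *ₛ g ≈ₛ f′ *ₛ g′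
  *ₛ-cong f≈ g≈ zero    = *-cong (f≈ 0) (g≈ 0)
  *ₛ-cong f≈ g≈ (suc n) = +-cong (*-cong (f≈ 0) (g≈ (suc n))) (*ₛ-cong (f≈ ∘ suc) g≈ n)

  *ₛ-zeroˡ : ∀ g → 0ₛ *ₛ g ≈ₛ 0ₛ
  *ₛ-zeroˡ g zero    = zeroˡ (g 0)
  *ₛ-zeroˡ g (suc n) = trans (+-cong (zeroˡ _) (*ₛ-zeroˡ g n)) (+-identityˡ 0#)

  const-*ₛ : ∀ a g n → (const a *ₛ g) n ≈ a * g n
  const-*ₛ a g zero    = refl
  const-*ₛ a g (suc n) = trans (+-congˡ (*ₛ-zeroˡ g n)) (+-identityʳ _)

  X-*ₛ-zero : ∀ g → (X *ₛ g) 0 ≈ 0#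
  X-*ₛ-zero g = zeroˡ (g 0)

  X-*ₛ-suc : ∀ g n → (X *ₛ g) (suc n) ≈ g n
  X-*ₛ-suc g n = begin
    0# * g (suc n) + (1ₛ *ₛ g) n ≈⟨ +-cong (zeroˡ _) (const-*ₛ 1# g n) ⟩
    0# + 1# * g n                ≈⟨ +-identityˡ _ ⟩
    1# * g n                     ≈⟨ *-identityˡ _ ⟩
    g n                          ∎

  *ₛ-distribʳ : ∀ f g h → (f +ₛ g) *ₛ h ≈ₛ f *ₛ h +ₛ g *ₛ h
  *ₛ-distribʳ f g h zero    = distribʳ _ _ _
  *ₛ-distribʳ f g h (suc n) =
    trans (+-cong (distribʳ _ _ _) (*ₛ-distribʳ (tail f) (tail g) h n)) (interchange _ _ _ _)

  *ₛ-distribˡ : ∀ h f g → h *ₛ (f +ₛ g) ≈ₛ h *ₛ f +ₛ h *ₛ g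
  *ₛ-distribˡ h f g zero    = distribˡ _ _ _
  *ₛ-distribˡ h f g (suc n) =
    trans (+-cong (distribˡ _ _ _) (*ₛ-distribˡ (tail h) f g n)) (interchange _ _ _ _)

  *ₛ-scaleˡ : ∀ a g h → (a ·ₛ g) *ₛ h ≈ₛ a ·ₛ (g *ₛ h)
  *ₛ-scaleˡ a g h zero    = *-assoc _ _ _
  *ₛ-scaleˡ a g h (suc n) =
    trans (+-cong (*-assoc _ _ _) (*ₛ-scaleˡ a (tail g) h n)) (sym (distribˡ _ _ _))

  *ₛ-assoc : ∀ f g h → (f *ₛ g) *ₛ h ≈ₛ f *ₛ (g *ₛ h)
  *ₛ-assoc f g h zero    = *-assoc _ _ _
  *ₛ-assoc f g h (suc n) = begin
    (f 0 * g 0) * h (suc n) + ((f 0 ·ₛ tail g +ₛ tail f *ₛ g) *ₛ h) n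
      ≈⟨ +-cong (*-assoc _ _ _) (*ₛ-distribʳ _ _ h n) ⟩
    f 0 * (g 0 * h (suc n)) + (((f 0 ·ₛ tail g) *ₛ h) n + ((tail f *ₛ g) *ₛ h) n)
      ≈⟨ +-congˡ (+-cong (*ₛ-scaleˡ (f 0) (tail g) h n) (*ₛ-assoc (tail f) g h n)) ⟩
    f 0 * (g 0 * h (suc n)) + (f 0 * (tail g *ₛ h) n + (tail f *ₛ (g *ₛ h)) n)
      ≈⟨ sym (+-assoc _ _ _) ⟩
    f 0 * (g 0 * h (suc n)) + f 0 * (tail g *ₛ h) n + (tail f *ₛ (g *ₛ h)) n
      ≈⟨ +-congʳ (sym (distribˡ _ _ _)) ⟩
    f 0 * (g 0 * h (suc n) + (tail g *ₛ h) n) + (tail f *ₛ (g *ₛ h)) n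
      ∎

  *ₛ-sucʳ : ∀ f g n → (f *ₛ g) (suc n) ≈ (f *ₛ tail g) n + f (suc n) * g 0
  *ₛ-sucʳ f g zero    = refl
  *ₛ-sucʳ f g (suc n) =
    trans (+-congˡ (*ₛ-sucʳ (tail f) g n)) (sym (+-assoc _ _ _))

  *ₛ-comm : ∀ f g → f *ₛ g ≈ₛ g *ₛ f
  *ₛ-comm f g zero    = *-comm _ _
  *ₛ-comm f g (suc n) = begin
    f 0 * g (suc n) + (tail f *ₛ g) n ≈⟨ +-cong (*-comm _ _) (*ₛ-comm (tail f) g n) ⟩
    g (suc n) * f 0 + (g *ₛ tail f) n ≈⟨ +-comm _ _ ⟩
    (g *ₛ tail f) n + g (suc n) * f 0 ≈⟨ sym (*ₛ-sucʳ g f n) ⟩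
    (g *ₛ f) (suc n)                  ∎

  *ₛ-identityˡ : ∀ g → 1ₛ *ₛ g ≈ₛ g
  *ₛ-identityˡ g n = trans (const-*ₛ 1# g n) (*-identityˡ _)

  commutativeRing : CommutativeRing c ℓ
  commutativeRing = record
    { Carrier = Series
    ; _≈_ = _≈ₛ_
    ; _+_ = _+ₛ_
    ; _*_ = _*ₛ_
    ; -_ = -ₛ_
    ; 0# = 0ₛ
    ; 1# = 1ₛ
    ; isCommutativeRing = record
      { isRing = record
        { +-isAbelianGroup = record
          { isGroup = record
            { isMonoid = record
              { isSemigroup = record
                { isMagma = record
                  { isEquivalence = record
                    { refl = λ _ → refl ; sym = λ p n → sym (p n) ; trans = λ p q n → trans (p n) (q n) }
                  ; ∙-cong = λ p q n → +-cong (p n) (q n) }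
                ; assoc = λ _ _ _ _ → +-assoc _ _ _ }
              ; identity = (λ _ _ → +-identityˡ _) , (λ _ _ → +-identityʳ _) }
            ; inverse = (λ _ _ → -‿inverseˡ _) , (λ _ _ → -‿inverseʳ _)
            ; ⁻¹-cong = λ p n → -‿cong (p n) }
          ; comm = λ _ _ _ → +-comm _ _ }
        ; *-cong = *ₛ-cong
        ; *-assoc = *ₛ-assoc
        ; *-identity = *ₛ-identityˡ , λ g n → trans (*ₛ-comm g 1ₛ n) (*ₛ-identityˡ g n)
        ; distrib = *ₛ-distribˡ , λ h f g → *ₛ-distribʳ f g h }
      ; *-comm = *ₛ-comm } }

  ∑ : List Carrier → Carrier
  ∑ = foldr _+_ 0#

  *ₛ-convolution : ∀ f g n → (f *ₛ g) n ≈ ∑ (map (λ i → f i * g (n ∸ i)) (upTo (suc n)))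
  *ₛ-convolution f g zero    = sym (+-identityʳ _)
  *ₛ-convolution f g (suc n) = +-congˡ (trans (*ₛ-convolution (tail f) g n) (reflexive (≡.cong ∑ shift)))
    where
    term : ℕ → Carrier
    term i = f i * g (suc n ∸ i)
    shift : map (term ∘ suc) (upTo (suc n)) ≡ map term (applyUpTo suc (suc n))
    shift = ≡.trans (map-applyUpTo (λ i → i) (term ∘ suc) (suc n)) (≡.sym (map-applyUpTo suc term (suc n)))

  ∑-coeff : ∀ (fs : List Series) n → foldr _+ₛ_ 0ₛ fs n ≈ ∑ (map (λ f → f n) fs)
  ∑-coeff []       n = refl
  ∑-coeff (f ∷ fs) n = +-congˡ (∑-coeff fs n)

  const-cong : ∀ {a b} → a ≈ b → const a ≈ₛ const b
  const-cong a≈b zero    = a≈b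
  const-cong a≈b (suc n) = refl

  liftMorphism : ∀ {r₁ r₂} {Coeff : RawRing r₁ r₂} →
                 Coeff -Raw-AlmostCommutative⟶ fromCommutativeRing R →
                 Coeff -Raw-AlmostCommutative⟶ fromCommutativeRing commutativeRing
  liftMorphism {Coeff = Coeff} φ = record
    { ⟦_⟧    = const ∘ ⟦_⟧
    ; +-homo = λ a b → λ { zero → +-homo a b ; (suc n) → sym (+-identityʳ 0#) }
    ; *-homo = λ a b n → trans (homo-* a b n) (sym (const-*ₛ _ _ n))
    ; -‿homo = λ a → λ { zero → -‿homo a ; (suc n) → sym ε⁻¹≈ε }
    ; 0-homo = λ { zero → 0-homo ; (suc n) → refl }
    ; 1-homo = const-cong 1-homo
    }
    where
    open _-Raw-AlmostCommutative⟶_ φ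
    open RawRing Coeff using () renaming (_*_ to _*ᶜ_)
    open import Algebra.Properties.Group +-group using (ε⁻¹≈ε)
    homo-* : ∀ a b n → const ⟦ a *ᶜ b ⟧ n ≈ ⟦ a ⟧ * const ⟦ b ⟧ n
    homo-* a b zero    = *-homo a b
    homo-* a b (suc n) = sym (zeroʳ _)

  infix 4 _≈[<_]_
  record _≈[<_]_ (f : Series) (m : ℕ) (g : Series) : Set ℓ where
    constructor agree
    field coeff : ∀ {n} → n < m → f n ≈ g n
  open _≈[<_]_ public

  ≈[<]-refl : ∀ {f m} → f ≈[< m ] f
  ≈[<]-refl = agree λ _ → refl

  ≈[<]-trans : ∀ {f g h m} → f ≈[< m ] g → g ≈[< m ] h → f ≈[< m ] h
  ≈[<]-trans p q = agree λ n<m → trans (coeff p n<m) (coeff q n<m)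

  ≈[<]-weaken : ∀ {f g m m′} → m′ ≤ m → f ≈[< m ] g → f ≈[< m′ ] g
  ≈[<]-weaken m′≤m p = agree λ n<m′ → coeff p (ℕ.<-≤-trans n<m′ m′≤m)

  +ₛ-cong-< : ∀ {f f′ g g′ m} → f ≈[< m ] f′ → g ≈[< m ] g′ → f +ₛ g ≈[< m ] f′ +ₛ g′
  +ₛ-cong-< p q = agree λ n<m → +-cong (coeff p n<m) (coeff q n<m)

  *ₛ-cong-< : ∀ {f f′ g g′ m} → f ≈[< m ] f′ → g ≈[< m ] g′ → f *ₛ g ≈[< m ] f′ *ₛ g′
  *ₛ-cong-< p q = agree λ n<m →
    local _ (λ i≤n → coeff p (ℕ.≤-<-trans i≤n n<m)) (λ i≤n → coeff q (ℕ.≤-<-trans i≤n n<m))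
    where
    local : ∀ {f f′ g g′} n → (∀ {i} → i ≤ n → f i ≈ f′ i) → (∀ {i} → i ≤ n → g i ≈ g′ i) →
            (f *ₛ g) n ≈ (f′ *ₛ g′) n
    local zero    f≈ g≈ = *-cong (f≈ z≤n) (g≈ z≤n)
    local (suc n) f≈ g≈ =
      +-cong (*-cong (f≈ z≤n) (g≈ ℕ.≤-refl)) (local n (f≈ ∘ s≤s) (g≈ ∘ ℕ.m≤n⇒m≤1+n))

  X-*ₛ-cong-< : ∀ {f g m} → f ≈[< m ] g → X *ₛ f ≈[< suc m ] X *ₛ g
  X-*ₛ-cong-< {f} {g} {m} p = agree shifted
    where
    shifted : ∀ {n} → n < suc m → (X *ₛ f) n ≈ (X *ₛ g) n
    shifted {zero}  _         = trans (X-*ₛ-zero f) (sym (X-*ₛ-zero g))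
    shifted {suc n} (s≤s n<m) = trans (X-*ₛ-suc f n) (trans (coeff p n<m) (sym (X-*ₛ-suc g n)))

  module Contraction {i} {I : Set i} (Φ : (I → Series) → I → Series)
    (contracts : ∀ {m F G} → (∀ j → F j ≈[< m ] G j) → ∀ j → Φ F j ≈[< suc m ] Φ G j) where

    private
      iterate : ℕ → I → Series
      iterate zero    _ = 0ₛ
      iterate (suc m)   = Φ (iterate m)

      iterate-step : ∀ m j → iterate m j ≈[< m ] iterate (suc m) j
      iterate-step zero    j = agree λ ()
      iterate-step (suc m) j = contracts (iterate-step m) j

      iterate-stable : ∀ {m m′} → m ℕ.≤′ m′ → ∀ j → iterate m j ≈[< m ] iterate m′ j
      iterate-stable ℕ.≤′-refl       j = ≈[<]-refl
      iterate-stable (ℕ.≤′-step m≤m′) j =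
        ≈[<]-trans (iterate-stable m≤m′ j) (≈[<]-weaken (ℕ.≤′⇒≤ m≤m′) (iterate-step _ j))

    fix : I → Series
    fix j n = iterate (suc n) j n

    private
      fix-≈[<]-iterate : ∀ m j → fix j ≈[< m ] iterate m j
      fix-≈[<]-iterate m j = agree λ {n} n<m → coeff (iterate-stable (ℕ.≤⇒≤′ n<m) j) (ℕ.n<1+n n)

    fix-isFixedPoint : ∀ j → Φ fix j ≈ₛ fix j
    fix-isFixedPoint j n = coeff (contracts (fix-≈[<]-iterate n) j) (ℕ.n<1+n n)

    fixedPoint-unique : ∀ {F G} → (∀ j → F j ≈ₛ Φ F j) → (∀ j → G j ≈ₛ Φ G j) → ∀ j → F j ≈ₛ G j
    fixedPoint-unique {F} {G} F≈ΦF G≈ΦG j n = coeff (agreeUpTo (suc n) j) (ℕ.n<1+n n)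
      where
      agreeUpTo : ∀ m j → F j ≈[< m ] G j
      agreeUpTo zero    j = agree λ ()
      agreeUpTo (suc m) j = agree λ n<m →
        trans (F≈ΦF j _) (trans (coeff (contracts (agreeUpTo m) j) n<m) (sym (G≈ΦG j _)))

-- free h: paths from height h whose previous step is not U;
-- opening h: paths from height h + 1 right after a U that starts an ascent;
-- climbing h: paths from height h + 1 inside an ascent of at least two U steps.
data Index : Set where
  free opening climbing : ℕ → Index

module ClosedForm {c ℓ} (R : CommutativeRing c ℓ)
  (ι : CommutativeRing.rawRing ℤ.+-*-commutativeRing -Raw-AlmostCommutative⟶ fromCommutativeRing R)
  where

  open CommutativeRing R
  open _-Raw-AlmostCommutative⟶_ ι using () renaming (⟦_⟧ to κ)
  open import Algebra.Properties.Group +-group using (x∙y⁻¹≈ε⇒x≈y; x≈y⇒x∙y⁻¹≈ε)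
  open import Relation.Binary.Reasoning.Setoid setoid

  private
    κ-≟ : WeaklyDecidable (λ a b → κ a ≈ κ b)
    κ-≟ a b with a ℤ.≟ b
    ... | yes ≡.refl = just refl
    ... | no _       = nothing

  open import Algebra.Solver.Ring _ _ ι κ-≟ using (solve; _:=_; _:+_; _:-_; _:*_; con; Polynomial)

  denominator numerator Δ : Carrier → Carrier → Carrier
  denominator z t = z * z + κ (+ 1) - κ (+ 2) * z - z * z * z + z * z * z * t - z * z * t
  numerator z t = κ (ℤ.- + 1) + κ (+ 2) * z - z * z + z * z * t
  Δ z t = κ (+ 1) - κ (+ 2) * (t + κ (+ 1)) * z * z - (t + κ (+ 3)) * (κ (+ 1) - t) * z * z * z * z

  W : Carrier → Carrier → Carrier → Carrier
  W z t f = κ (+ 2) * z * denominator z t * f - numerator z t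

  B : Carrier → Carrier → Carrier → Carrier → Carrier
  B z t x y = z * (y * x + t)

  firstStep : Carrier → (Index → Carrier) → Index → Carrier
  firstStep t G (free zero)    = G (opening 0) + G (free 0)
  firstStep t G (free (suc h)) = G (opening (suc h)) + G (free h)
  firstStep t G (opening h)    = G (climbing (suc h)) + t * G (free h)
  firstStep t G (climbing h)   = G (climbing (suc h)) + G (free h)

  system : Carrier → Carrier → (Index → Carrier) → Index → Carrier
  system z t G (free zero)    = κ (+ 1) + z * firstStep t G (free 0)
  system z t G (free (suc h)) = z * firstStep t G (free (suc h))
  system z t G (opening h)    = z * firstStep t G (opening h)
  system z t G (climbing h)   = z * firstStep t G (climbing h)

  private
    1ᵖ 2ᵖ : ∀ {n} → Polynomial n
    1ᵖ = con (+ 1)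
    2ᵖ = con (+ 2)
    Dᵖ Nᵖ Δᵖ uᵖ Aᵖ : ∀ {n} → Polynomial n → Polynomial n → Polynomial n
    Dᵖ z t = z :* z :+ 1ᵖ :- 2ᵖ :* z :- z :* z :* z :+ z :* z :* z :* t :- z :* z :* t
    Nᵖ z t = con (ℤ.- + 1) :+ 2ᵖ :* z :- z :* z :+ z :* z :* t
    Δᵖ z t = 1ᵖ :- 2ᵖ :* (t :+ 1ᵖ) :* z :* z :- (t :+ con (+ 3)) :* (1ᵖ :- t) :* z :* z :* z :* z
    uᵖ z t = 1ᵖ :+ z :* z :* (1ᵖ :- t)
    Aᵖ z t = 1ᵖ :- z :+ z :* z :* (1ᵖ :- t)
    Bᵖ : ∀ {n} → Polynomial n → Polynomial n → Polynomial n → Polynomial n → Polynomial n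
    Bᵖ z t x y = z :* (y :* x :+ t)

  W≈1+z* : ∀ z t f → W z t f ≈ κ (+ 1) + z * (κ (+ 2) * denominator z t * f - (κ (+ 2) - z + z * t))
  W≈1+z* = solve 3 (λ z t f → 2ᵖ :* z :* Dᵖ z t :* f :- Nᵖ z t
                            := 1ᵖ :+ z :* (2ᵖ :* Dᵖ z t :* f :- (2ᵖ :- z :+ z :* t))) refl

  module _ {z t x y f : Carrier}
           (y-eq : y ≈ z * (κ (+ 1) + y * x))
           (x-eq : x ≈ z * (κ (+ 1) + B z t x y * x))
           (f-eq : f ≈ κ (+ 1) + z * (B z t x y * f + f)) where

    private
      u A : Carrier
      u = κ (+ 1) + z * z * (κ (+ 1) - t)
      A = κ (+ 1) - z + z * z * (κ (+ 1) - t)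

      vanishes : ∀ {a b} → a ≈ b → ∀ e → e * (a - b) ≈ 0#
      vanishes a≈b e = trans (*-congˡ (x≈y⇒x∙y⁻¹≈ε a≈b)) (zeroʳ e)

      vanish₂ : ∀ {a b c} → a ≈ 0# → b ≈ 0# → a + b ≈ c → c ≈ 0#
      vanish₂ a≈0 b≈0 a+b≈c = trans (sym a+b≈c) (trans (+-cong a≈0 b≈0) (+-identityʳ 0#))

      vanish₃ : ∀ {a b c d} → a ≈ 0# → b ≈ 0# → c ≈ 0# → a + b + c ≈ d → d ≈ 0#
      vanish₃ a≈0 b≈0 c≈0 = vanish₂ (vanish₂ a≈0 b≈0 refl) c≈0

    xʰf : ℕ → Carrier
    xʰf zero    = f
    xʰf (suc h) = x * xʰf h

    family : Index → Carrier
    family (free h)     = xʰf h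
    family (opening h)  = B z t x y * xʰf h
    family (climbing h) = y * xʰf h

    family-solves-system : ∀ i → family i ≈ system z t family i
    family-solves-system (free zero)    = f-eq
    family-solves-system (free (suc h)) = begin
      x * xʰf h                                   ≈⟨ *-congʳ x-eq ⟩
      z * (κ (+ 1) + B z t x y * x) * xʰf h       ≈⟨ solve 5 (λ z t x y g → z :* (1ᵖ :+ Bᵖ z t x y :* x) :* g
                                                              := z :* (Bᵖ z t x y :* (x :* g) :+ g)) refl z t x y (xʰf h) ⟩
      z * (B z t x y * (x * xʰf h) + xʰf h)       ∎
    family-solves-system (opening h)    =
      solve 5 (λ z t x y g → Bᵖ z t x y :* g := z :* (y :* (x :* g) :+ t :* g)) refl z t x y (xʰf h)
    family-solves-system (climbing h)   = begin
      y * xʰf h                                   ≈⟨ *-congʳ y-eq ⟩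
      z * (κ (+ 1) + y * x) * xʰf h               ≈⟨ solve 4 (λ z x y g → z :* (1ᵖ :+ y :* x) :* g
                                                              := z :* (y :* (x :* g) :+ g)) refl z x y (xʰf h) ⟩
      z * (y * (x * xʰf h) + xʰf h)               ∎

    y≈u*x : y ≈ u * x
    y≈u*x = x∙y⁻¹≈ε⇒x≈y _ _ (vanish₂ (vanishes y-eq (κ (+ 1) + z * x)) (vanishes x-eq (κ (ℤ.- + 1)))
      (solve 5 (λ z t x y f → (1ᵖ :+ z :* x) :* (y :- z :* (1ᵖ :+ y :* x))
                             :+ con (ℤ.- + 1) :* (x :- z :* (1ᵖ :+ Bᵖ z t x y :* x))
                             := y :- uᵖ z t :* x) refl z t x y f))

    x-quadratic : z * u * x * x + z ≈ u * x
    x-quadratic = x∙y⁻¹≈ε⇒x≈y _ _ (vanish₂ (vanishes y-eq (κ (ℤ.- + 1))) (vanishes y≈u*x (κ (+ 1) - z * x))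
      (solve 5 (λ z t x y f → con (ℤ.- + 1) :* (y :- z :* (1ᵖ :+ y :* x))
                             :+ (1ᵖ :- z :* x) :* (y :- uᵖ z t :* x)
                             := z :* uᵖ z t :* x :* x :+ z :- uᵖ z t :* x) refl z t x y f))

    f-linear : (A - z * u * x) * f ≈ κ (+ 1)
    f-linear = x∙y⁻¹≈ε⇒x≈y _ _ (vanish₃ (vanishes f-eq (κ (+ 1))) (vanishes y≈u*x (z * f))
                                        (vanishes y-eq (κ (ℤ.- + 1) * z * f))
      (solve 5 (λ z t x y f → 1ᵖ :* (f :- (1ᵖ :+ z :* (Bᵖ z t x y :* f :+ f)))
                             :+ z :* f :* (y :- uᵖ z t :* x)
                             :+ con (ℤ.- + 1) :* z :* f :* (y :- z :* (1ᵖ :+ y :* x))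
                             := (Aᵖ z t :- z :* uᵖ z t :* x) :* f :- 1ᵖ) refl z t x y f))

    f-quadratic : z * denominator z t * f * f ≈ numerator z t * f + κ (+ 1)
    f-quadratic = x∙y⁻¹≈ε⇒x≈y _ _ (vanish₂ (vanishes x-quadratic (κ (ℤ.- + 1) * z * u * f * f))
                                           (vanishes f-linear (u * f - A * f + κ (+ 1) - z * u * x * f))
      (solve 5 (λ z t x y f → con (ℤ.- + 1) :* z :* uᵖ z t :* f :* f :* (z :* uᵖ z t :* x :* x :+ z :- uᵖ z t :* x)
                             :+ (uᵖ z t :* f :- Aᵖ z t :* f :+ 1ᵖ :- z :* uᵖ z t :* x :* f)
                                :* ((Aᵖ z t :- z :* uᵖ z t :* x) :* f :- 1ᵖ)
                             := z :* Dᵖ z t :* f :* f :- (Nᵖ z t :* f :+ 1ᵖ)) refl z t x y f))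

    W-squared : W z t f * W z t f ≈ Δ z t
    W-squared = x∙y⁻¹≈ε⇒x≈y _ _ (trans
      (solve 3 (λ z t f → (2ᵖ :* z :* Dᵖ z t :* f :- Nᵖ z t) :* (2ᵖ :* z :* Dᵖ z t :* f :- Nᵖ z t) :- Δᵖ z t
                        := con (+ 4) :* z :* Dᵖ z t :* (z :* Dᵖ z t :* f :* f :- (Nᵖ z t :* f :+ 1ᵖ))) refl z t f)
      (vanishes f-quadratic (κ (+ 4) * z * denominator z t)))

open ≡ using (refl; cong; cong₂)

count : (List Step → Bool) → ℕ → ℕ
count p n = length (filterᵇ p (words n))

private
  𝟙 : Bool → ℕ
  𝟙 b = if b then 1 else 0

  #[_] : ∀ {A : Set} → (A → Bool) → List A → ℕ
  #[ p ] []       = 0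
  #[ p ] (x ∷ xs) = 𝟙 (p x) ℕ.+ #[ p ] xs

  length-filterᵇ : ∀ {A : Set} (p : A → Bool) xs → length (filterᵇ p xs) ≡ #[ p ] xs
  length-filterᵇ p []       = refl
  length-filterᵇ p (x ∷ xs) with p x
  ... | true  = cong suc (length-filterᵇ p xs)
  ... | false = length-filterᵇ p xs

  #-++ : ∀ {A : Set} (p : A → Bool) xs ys → #[ p ] (xs ++ ys) ≡ #[ p ] xs ℕ.+ #[ p ] ys
  #-++ p []       ys = refl
  #-++ p (x ∷ xs) ys =
    ≡.trans (cong (𝟙 (p x) ℕ.+_) (#-++ p xs ys)) (≡.sym (ℕ.+-assoc (𝟙 (p x)) (#[ p ] xs) (#[ p ] ys)))

  extend : List Step → List (List Step)
  extend w = (U ∷ w) ∷ (D ∷ w) ∷ (H ∷ w) ∷ []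

  regroup : ∀ a b c d e f → a ℕ.+ (b ℕ.+ (c ℕ.+ 0)) ℕ.+ (d ℕ.+ e ℕ.+ f) ≡ a ℕ.+ d ℕ.+ (b ℕ.+ e) ℕ.+ (c ℕ.+ f)
  regroup = solve-∀

  #-extend : ∀ p ws → #[ p ] (concatMap extend ws) ≡ #[ p ∘ (U ∷_) ] ws ℕ.+ #[ p ∘ (D ∷_) ] ws ℕ.+ #[ p ∘ (H ∷_) ] ws
  #-extend p []       = refl
  #-extend p (w ∷ ws) = ≡.trans (#-++ p (extend w) (concatMap extend ws))
    (≡.trans (cong (#[ p ] (extend w) ℕ.+_) (#-extend p ws))
             (regroup (𝟙 (p (U ∷ w))) (𝟙 (p (D ∷ w))) (𝟙 (p (H ∷ w)))
                      (#[ p ∘ (U ∷_) ] ws) (#[ p ∘ (D ∷_) ] ws) (#[ p ∘ (H ∷_) ] ws)))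

count-first-step : ∀ p n → count p (suc n) ≡ count (p ∘ (U ∷_)) n ℕ.+ count (p ∘ (D ∷_)) n ℕ.+ count (p ∘ (H ∷_)) n
count-first-step p n = begin
  count p (suc n)                        ≡⟨ length-filterᵇ p (concatMap extend (words n)) ⟩
  #[ p ] (concatMap extend (words n))    ≡⟨ #-extend p (words n) ⟩
  #[ p ∘ (U ∷_) ] (words n) ℕ.+ #[ p ∘ (D ∷_) ] (words n) ℕ.+ #[ p ∘ (H ∷_) ] (words n)
    ≡⟨ cong₂ ℕ._+_ (cong₂ ℕ._+_ (sym′ (U ∷_)) (sym′ (D ∷_))) (sym′ (H ∷_)) ⟩
  count (p ∘ (U ∷_)) n ℕ.+ count (p ∘ (D ∷_)) n ℕ.+ count (p ∘ (H ∷_)) n ∎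
  where
  open ≡.≡-Reasoning
  sym′ : ∀ s → #[ p ∘ s ] (words n) ≡ count (p ∘ s) n
  sym′ s = ≡.sym (length-filterᵇ (p ∘ s) (words n))

count-cong : ∀ {p q} → (∀ w → p w ≡ q w) → ∀ n → count p n ≡ count q n
count-cong {p} {q} p≗q n =
  ≡.trans (length-filterᵇ p (words n)) (≡.trans (#-cong (words n)) (≡.sym (length-filterᵇ q (words n))))
  where
  #-cong : ∀ ws → #[ p ] ws ≡ #[ q ] ws
  #-cong []       = refl
  #-cong (w ∷ ws) = cong₂ (λ b m → 𝟙 b ℕ.+ m) (p≗q w) (#-cong ws)

count-none : ∀ n → count (λ _ → false) n ≡ 0
count-none n = ≡.trans (length-filterᵇ _ (words n)) (none (words n))
  where
  none : ∀ ws → #[ (λ _ → false) ] ws ≡ 0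
  none []       = refl
  none (_ ∷ ws) = none ws

count-step-noD : ∀ p n → (∀ w → p (D ∷ w) ≡ false) → count p (suc n) ≡ count (p ∘ (U ∷_)) n ℕ.+ count (p ∘ (H ∷_)) n
count-step-noD p n noD = ≡.trans (count-first-step p n) (≡.trans
  (cong (λ m → count (p ∘ (U ∷_)) n ℕ.+ m ℕ.+ count (p ∘ (H ∷_)) n) (≡.trans (count-cong noD n) (count-none n)))
  (cong (ℕ._+ count (p ∘ (H ∷_)) n) (ℕ.+-identityʳ _)))

count-step-noH : ∀ p n → (∀ w → p (H ∷ w) ≡ false) → count p (suc n) ≡ count (p ∘ (U ∷_)) n ℕ.+ count (p ∘ (D ∷_)) n
count-step-noH p n noH = ≡.trans (count-first-step p n)
  (≡.trans (cong (count (p ∘ (U ∷_)) n ℕ.+ count (p ∘ (D ∷_)) n ℕ.+_) (≡.trans (count-cong noH n) (count-none n)))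
           (ℕ.+-identityʳ _))

n/2≡⌊n/2⌋ : ∀ n → n / 2 ≡ ⌊ n /2⌋
n/2≡⌊n/2⌋ zero          = refl
n/2≡⌊n/2⌋ (suc zero)    = refl
n/2≡⌊n/2⌋ (suc (suc n)) = ≡.trans (m/n≡1+[m∸n]/n {suc (suc n)} {2} (s≤s (s≤s z≤n))) (cong suc (n/2≡⌊n/2⌋ n))

nC⌈n/2⌉≡nC⌊n/2⌋ : ∀ n → n C ⌈ n /2⌉ ≡ n C ⌊ n /2⌋
nC⌈n/2⌉≡nC⌊n/2⌋ n = ≡.trans (cong (n C_) ⌈n/2⌉≡n∸⌊n/2⌋) (≡.sym (nCk≡nC[n∸k] (ℕ.⌊n/2⌋≤n n)))
  where
  ⌈n/2⌉≡n∸⌊n/2⌋ : ⌈ n /2⌉ ≡ n ∸ ⌊ n /2⌋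
  ⌈n/2⌉≡n∸⌊n/2⌋ = ≡.trans (≡.sym (ℕ.m+n∸m≡n ⌊ n /2⌋ ⌈ n /2⌉)) (cong (_∸ ⌊ n /2⌋) (ℕ.⌊n/2⌋+⌈n/2⌉≡n n))

count-validFrom : ∀ h n → count (validFrom h) n ≡ n C ⌈ h ℕ.+ n /2⌉
count-validFrom zero    zero    = refl
count-validFrom (suc h) zero    = refl
count-validFrom zero    (suc n) = begin
  count (validFrom 0) (suc n)                       ≡⟨ count-step-noD (validFrom 0) n (λ _ → refl) ⟩
  count (validFrom 1) n ℕ.+ count (validFrom 0) n
    ≡⟨ cong₂ ℕ._+_ (count-validFrom 1 n) (≡.trans (count-validFrom 0 n) (nC⌈n/2⌉≡nC⌊n/2⌋ n)) ⟩
  n C suc ⌊ n /2⌋ ℕ.+ n C ⌊ n /2⌋                   ≡⟨ ℕ.+-comm (n C suc ⌊ n /2⌋) _ ⟩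
  n C ⌊ n /2⌋ ℕ.+ n C suc ⌊ n /2⌋                   ≡⟨ nCk+nC[k+1]≡[n+1]C[k+1] n ⌊ n /2⌋ ⟩
  suc n C suc ⌊ n /2⌋                               ∎
  where open ≡.≡-Reasoning
count-validFrom (suc h) (suc n) = begin
  count (validFrom (suc h)) (suc n)                         ≡⟨ count-step-noH (validFrom (suc h)) n (λ _ → refl) ⟩
  count (validFrom (suc (suc h))) n ℕ.+ count (validFrom h) n
    ≡⟨ cong₂ ℕ._+_ (count-validFrom (suc (suc h)) n) (count-validFrom h n) ⟩
  n C suc ⌈ h ℕ.+ n /2⌉ ℕ.+ n C ⌈ h ℕ.+ n /2⌉               ≡⟨ ℕ.+-comm (n C suc ⌈ h ℕ.+ n /2⌉) _ ⟩
  n C ⌈ h ℕ.+ n /2⌉ ℕ.+ n C suc ⌈ h ℕ.+ n /2⌉               ≡⟨ nCk+nC[k+1]≡[n+1]C[k+1] n ⌈ h ℕ.+ n /2⌉ ⟩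
  suc n C suc ⌈ h ℕ.+ n /2⌉                                 ≡⟨ cong (λ m → suc n C ⌈ suc m /2⌉) (ℕ.+-suc h n) ⟨
  suc n C ⌈ suc h ℕ.+ suc n /2⌉                             ∎
  where open ≡.≡-Reasoning

numDispersed≡nC[n/2] : ∀ n → numDispersed n ≡ n C (n / 2)
numDispersed≡nC[n/2] n =
  ≡.trans (count-validFrom 0 n) (≡.trans (nC⌈n/2⌉≡nC⌊n/2⌋ n) (cong (n C_) (≡.sym (n/2≡⌊n/2⌋ n))))

module ℤ⟦t⟧ = PowerSeries ℤ.+-*-commutativeRing
module ℤ⟦t⟧⟦z⟧ = PowerSeries ℤ⟦t⟧.commutativeRing

-- Its carrier ℕ → ℕ → ℤ is Ser: the coefficient of z^n t^k sits at n k.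
ℤ⟦t,z⟧ : CommutativeRing 0ℓ 0ℓ
ℤ⟦t,z⟧ = ℤ⟦t⟧⟦z⟧.commutativeRing

ℤ-constants : CommutativeRing.rawRing ℤ.+-*-commutativeRing -Raw-AlmostCommutative⟶ fromCommutativeRing ℤ⟦t,z⟧
ℤ-constants =
  ℤ⟦t⟧⟦z⟧.liftMorphism (ℤ⟦t⟧.liftMorphism (-raw-almostCommutative⟶ (fromCommutativeRing ℤ.+-*-commutativeRing)))

open CommutativeRing ℤ⟦t,z⟧ using (_≈_; _+_; _*_; _-_)
open ClosedForm ℤ⟦t,z⟧ ℤ-constants
open ℤ⟦t⟧⟦z⟧ using (_≈[<_]_; ≈[<]-refl; ≈[<]-weaken; +ₛ-cong-<; *ₛ-cong-<; X-*ₛ-cong-<; module Contraction)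

κ : ℤ → Ser
κ = _-Raw-AlmostCommutative⟶_.⟦_⟧ ℤ-constants

z t : Ser
z = ℤ⟦t⟧⟦z⟧.X
t = ℤ⟦t⟧⟦z⟧.const ℤ⟦t⟧.X

z*-coeff-zero : ∀ F k → (z * F) 0 k ≡ + 0
z*-coeff-zero F = ℤ⟦t⟧⟦z⟧.X-*ₛ-zero F

z*-coeff-suc : ∀ F n k → (z * F) (suc n) k ≡ F n k
z*-coeff-suc = ℤ⟦t⟧⟦z⟧.X-*ₛ-suc

t*-coeff-zero : ∀ F n → (t * F) n 0 ≡ + 0
t*-coeff-zero F n = ≡.trans (ℤ⟦t⟧⟦z⟧.const-*ₛ ℤ⟦t⟧.X F n 0) (ℤ⟦t⟧.X-*ₛ-zero (F n))

t*-coeff-suc : ∀ F n k → (t * F) n (suc k) ≡ F n k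
t*-coeff-suc F n k = ≡.trans (ℤ⟦t⟧⟦z⟧.const-*ₛ ℤ⟦t⟧.X F n (suc k)) (ℤ⟦t⟧.X-*ₛ-suc (F n) k)

⊗≈* : ∀ F G → F ⊗ G ≈ F * G
⊗≈* F G n k = ≡.sym (begin
  (F * G) n k
    ≡⟨ ℤ⟦t⟧⟦z⟧.*ₛ-convolution F G n k ⟩
  foldr ℤ⟦t⟧._+ₛ_ ℤ⟦t⟧.0ₛ (map (λ i → F i ℤ⟦t⟧.*ₛ G (n ∸ i)) (upTo (suc n))) k
    ≡⟨ ℤ⟦t⟧.∑-coeff (map (λ i → F i ℤ⟦t⟧.*ₛ G (n ∸ i)) (upTo (suc n))) k ⟩
  sumℤ (map (λ s → s k) (map (λ i → F i ℤ⟦t⟧.*ₛ G (n ∸ i)) (upTo (suc n))))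
    ≡⟨ cong sumℤ (map-∘ {g = λ s → s k} {f = λ i → F i ℤ⟦t⟧.*ₛ G (n ∸ i)} (upTo (suc n))) ⟨
  sumℤ (map (λ i → (F i ℤ⟦t⟧.*ₛ G (n ∸ i)) k) (upTo (suc n)))
    ≡⟨ cong sumℤ (map-cong (λ i → ℤ⟦t⟧.*ₛ-convolution (F i) (G (n ∸ i)) k) (upTo (suc n))) ⟩
  (F ⊗ G) n k ∎)
  where open ≡.≡-Reasoning

⊗-cong : ∀ {F F′ G G′} → F ≈ F′ → G ≈ G′ → F ⊗ G ≈ F′ * G′
⊗-cong {F} {F′} {G} {G′} F≈ G≈ n k = ≡.trans (⊗≈* F G n k) (ℤ⟦t⟧⟦z⟧.*ₛ-cong F≈ G≈ n k)

⊕-cong : ∀ {F F′ G G′} → F ≈ F′ → G ≈ G′ → F ⊕ G ≈ F′ + G′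
⊕-cong F≈ G≈ n k = cong₂ ℤ._+_ (F≈ n k) (G≈ n k)

⊖-cong : ∀ {F F′ G G′} → F ≈ F′ → G ≈ G′ → F ⊖ G ≈ F′ - G′
⊖-cong F≈ G≈ n k = cong₂ ℤ._-_ (F≈ n k) (G≈ n k)

cst≈κ : ∀ c → cst c ≈ κ c
cst≈κ c zero    zero    = refl
cst≈κ c zero    (suc k) = refl
cst≈κ c (suc n) k       = refl

Z≈z : Z ≈ z
Z≈z zero          zero    = refl
Z≈z zero          (suc k) = refl
Z≈z (suc zero)    zero    = refl
Z≈z (suc zero)    (suc k) = refl
Z≈z (suc (suc n)) k       = refl

T≈t : T ≈ t
T≈t zero    zero          = refl
T≈t zero    (suc zero)    = refl
T≈t zero    (suc (suc k)) = refl
T≈t (suc n) k             = refl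

denomP≈ : denomP ≈ denominator z t
denomP≈ = ⊖-cong (⊕-cong (⊖-cong (⊖-cong (⊕-cong (⊗-cong Z≈z Z≈z) (cst≈κ _)) (⊗-cong (cst≈κ _) Z≈z))
                                  (⊗-cong (⊗-cong Z≈z Z≈z) Z≈z))
                          (⊗-cong (⊗-cong (⊗-cong Z≈z Z≈z) Z≈z) T≈t))
                 (⊗-cong (⊗-cong Z≈z Z≈z) T≈t)

numerN≈ : numerN ≈ numerator z t
numerN≈ = ⊕-cong (⊖-cong (⊕-cong (cst≈κ _) (⊗-cong (cst≈κ _) Z≈z)) (⊗-cong Z≈z Z≈z)) (⊗-cong (⊗-cong Z≈z Z≈z) T≈t)

radicand≈ : radicand ≈ Δ z t
radicand≈ = ⊖-cong (⊖-cong (cst≈κ _) (⊗-cong (⊗-cong (⊗-cong (cst≈κ _) (⊕-cong T≈t (cst≈κ _))) Z≈z) Z≈z))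
                   (⊗-cong (⊗-cong (⊗-cong (⊗-cong (⊗-cong (⊕-cong T≈t (cst≈κ _)) (⊖-cong (cst≈κ _) T≈t)) Z≈z) Z≈z) Z≈z) Z≈z)

data Unknown : Set where
  ⟨x⟩ ⟨y⟩ ⟨f⟩ : Unknown

xyfSystem : (Unknown → Ser) → Unknown → Ser
xyfSystem v ⟨x⟩ = z * (κ (+ 1) + B z t (v ⟨x⟩) (v ⟨y⟩) * v ⟨x⟩)
xyfSystem v ⟨y⟩ = z * (κ (+ 1) + v ⟨y⟩ * v ⟨x⟩)
xyfSystem v ⟨f⟩ = κ (+ 1) + z * (B z t (v ⟨x⟩) (v ⟨y⟩) * v ⟨f⟩ + v ⟨f⟩)

B-contracts : ∀ {m x x′ y y′} → x ≈[< m ] x′ → y ≈[< m ] y′ → B z t x y ≈[< suc m ] B z t x′ y′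
B-contracts x≈ y≈ = X-*ₛ-cong-< (+ₛ-cong-< (*ₛ-cong-< y≈ x≈) (≈[<]-refl {f = t}))

xyfSystem-contracts : ∀ {m v w} → (∀ j → v j ≈[< m ] w j) → ∀ j → xyfSystem v j ≈[< suc m ] xyfSystem w j
xyfSystem-contracts {m} v≈w ⟨x⟩ = X-*ₛ-cong-< (+ₛ-cong-< (≈[<]-refl {f = κ (+ 1)})
  (*ₛ-cong-< (≈[<]-weaken (ℕ.n≤1+n m) (B-contracts (v≈w ⟨x⟩) (v≈w ⟨y⟩))) (v≈w ⟨x⟩)))
xyfSystem-contracts v≈w ⟨y⟩ = X-*ₛ-cong-< (+ₛ-cong-< (≈[<]-refl {f = κ (+ 1)}) (*ₛ-cong-< (v≈w ⟨y⟩) (v≈w ⟨x⟩)))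
xyfSystem-contracts {m} v≈w ⟨f⟩ = +ₛ-cong-< (≈[<]-refl {f = κ (+ 1)})
  (X-*ₛ-cong-< (+ₛ-cong-< (*ₛ-cong-< (≈[<]-weaken (ℕ.n≤1+n m) (B-contracts (v≈w ⟨x⟩) (v≈w ⟨y⟩))) (v≈w ⟨f⟩))
                          (v≈w ⟨f⟩)))

module XYF = Contraction xyfSystem xyfSystem-contracts

x y f : Ser
x = XYF.fix ⟨x⟩
y = XYF.fix ⟨y⟩
f = XYF.fix ⟨f⟩

x-eq : x ≈ z * (κ (+ 1) + B z t x y * x)
x-eq n k = ≡.sym (XYF.fix-isFixedPoint ⟨x⟩ n k)

y-eq : y ≈ z * (κ (+ 1) + y * x)
y-eq n k = ≡.sym (XYF.fix-isFixedPoint ⟨y⟩ n k)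

f-eq : f ≈ κ (+ 1) + z * (B z t x y * f + f)
f-eq n k = ≡.sym (XYF.fix-isFixedPoint ⟨f⟩ n k)

validWith : Bool → ℕ → ℕ → List Step → Bool
validWith b h k w = validFrom h w ∧ (oneAscFrom b w ≡ᵇ k)

-- opening is written with the explicit height suc h and the prefix U so that
-- validFrom and oneAscFrom compute on the first step of a path.
pathSeries : Index → Ser
pathSeries (free h)     n k = + count (validWith false h k) n
pathSeries (opening h)  n k = + count (λ w → validFrom (suc h) w ∧ (oneAscFrom false (U ∷ w) ≡ᵇ k)) n
pathSeries (climbing h) n k = + count (validWith true (suc h) k) n

+count-step-noD : ∀ p n → (∀ w → p (D ∷ w) ≡ false) →
                  + count p (suc n) ≡ + count (p ∘ (U ∷_)) n ℤ.+ + count (p ∘ (H ∷_)) n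
+count-step-noD p n noD = ≡.trans (cong +_ (count-step-noD p n noD)) (ℤ.pos-+ (count (p ∘ (U ∷_)) n) (count (p ∘ (H ∷_)) n))

+count-step-noH : ∀ p n → (∀ w → p (H ∷ w) ≡ false) →
                  + count p (suc n) ≡ + count (p ∘ (U ∷_)) n ℤ.+ + count (p ∘ (D ∷_)) n
+count-step-noH p n noH = ≡.trans (cong +_ (count-step-noH p n noH)) (ℤ.pos-+ (count (p ∘ (U ∷_)) n) (count (p ∘ (D ∷_)) n))

peak-marks-1-ascent : ∀ h n k →
  + count (λ w → validFrom h w ∧ (suc (oneAscFrom false w) ≡ᵇ k)) n ≡ (t * pathSeries (free h)) n k
peak-marks-1-ascent h n zero    = ≡.trans (cong +_ (≡.trans (count-cong (λ _ → ∧-zeroʳ _) n) (count-none n)))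
                                          (≡.sym (t*-coeff-zero (pathSeries (free h)) n))
peak-marks-1-ascent h n (suc k) = ≡.sym (t*-coeff-suc (pathSeries (free h)) n k)

private
  afterFirstStep : Index → Ser
  afterFirstStep = firstStep t pathSeries

pathSeries-solves-system : ∀ i → pathSeries i ≈ system z t pathSeries i
pathSeries-solves-system (free zero) zero zero    =
  ≡.sym (cong (ℤ._+_ (+ 1)) (z*-coeff-zero (afterFirstStep (free 0)) 0))
pathSeries-solves-system (free zero) zero (suc k) =
  ≡.sym (cong (ℤ._+_ (+ 0)) (z*-coeff-zero (afterFirstStep (free 0)) (suc k)))
pathSeries-solves-system (free zero) (suc n) k    = ≡.trans (+count-step-noD _ n (λ _ → refl))
  (≡.sym (≡.trans (ℤ.+-identityˡ _) (z*-coeff-suc (afterFirstStep (free 0)) n k)))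
pathSeries-solves-system (free (suc h)) zero k    = ≡.sym (z*-coeff-zero (afterFirstStep (free (suc h))) k)
pathSeries-solves-system (free (suc h)) (suc n) k = ≡.trans (+count-step-noH _ n (λ _ → refl))
  (≡.sym (z*-coeff-suc (afterFirstStep (free (suc h))) n k))
pathSeries-solves-system (opening h) zero k       = ≡.sym (z*-coeff-zero (afterFirstStep (opening h)) k)
pathSeries-solves-system (opening h) (suc n) k    = ≡.trans (+count-step-noH _ n (λ _ → refl))
  (≡.trans (cong (ℤ._+_ (pathSeries (climbing (suc h)) n k)) (peak-marks-1-ascent h n k))
           (≡.sym (z*-coeff-suc (afterFirstStep (opening h)) n k)))
pathSeries-solves-system (climbing h) zero k      = ≡.sym (z*-coeff-zero (afterFirstStep (climbing h)) k)
pathSeries-solves-system (climbing h) (suc n) k   = ≡.trans (+count-step-noH _ n (λ _ → refl))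
  (≡.sym (z*-coeff-suc (afterFirstStep (climbing h)) n k))

system-contracts : ∀ {m F G} → (∀ i → F i ≈[< m ] G i) → ∀ i → system z t F i ≈[< suc m ] system z t G i
system-contracts F≈G (free zero)    = +ₛ-cong-< (≈[<]-refl {f = κ (+ 1)}) (X-*ₛ-cong-< (+ₛ-cong-< (F≈G _) (F≈G _)))
system-contracts F≈G (free (suc h)) = X-*ₛ-cong-< (+ₛ-cong-< (F≈G _) (F≈G _))
system-contracts F≈G (opening h)    = X-*ₛ-cong-< (+ₛ-cong-< (F≈G _) (*ₛ-cong-< (≈[<]-refl {f = t}) (F≈G _)))
system-contracts F≈G (climbing h)   = X-*ₛ-cong-< (+ₛ-cong-< (F≈G _) (F≈G _))

f0≈f : f0 ≈ f
f0≈f = Contraction.fixedPoint-unique (system z t) system-contracts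
         pathSeries-solves-system (family-solves-system y-eq x-eq f-eq) (free 0)

radical : Ser
radical = two ⊗ Z ⊗ denomP ⊗ f0 ⊖ numerN

radical≈W : radical ≈ W z t f
radical≈W = ⊖-cong (⊗-cong (⊗-cong (⊗-cong (cst≈κ (+ 2)) Z≈z) denomP≈) f0≈f) numerN≈

radical-constant-term : ∀ k → radical 0 k ≡ one 0 k
radical-constant-term k = begin
  radical 0 k                       ≡⟨ radical≈W 0 k ⟩
  W z t f 0 k                  ≡⟨ W≈1+z* z t f 0 k ⟩
  κ (+ 1) 0 k ℤ.+ (z * Q) 0 k  ≡⟨ cong (ℤ._+_ (κ (+ 1) 0 k)) (z*-coeff-zero Q k) ⟩
  κ (+ 1) 0 k ℤ.+ + 0          ≡⟨ ℤ.+-identityʳ _ ⟩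
  κ (+ 1) 0 k                  ≡⟨ cst≈κ (+ 1) 0 k ⟨
  one 0 k                      ∎
  where
  open ≡.≡-Reasoning
  Q : Ser
  Q = κ (+ 2) * denominator z t * f - (κ (+ 2) - z + z * t)

radical-squared : radical ⊗ radical ≈ radicand
radical-squared n k = ≡.trans (⊗-cong radical≈W radical≈W n k) (≡.trans (W-squared y-eq x-eq f-eq n k) (≡.sym (radicand≈ n k)))

mainTheorem1 : Σ Ser (λ W →
                   ((k : ℕ) → W 0 k ≡ one 0 k)
                 × ((n k : ℕ) → (W ⊗ W) n k ≡ radicand n k)
                 × ((n k : ℕ) → (two ⊗ Z ⊗ denomP ⊗ f0) n k ≡ (numerN ⊕ W) n k))
               × ((n : ℕ) → numDispersed n ≡ n C (n / 2))
mainTheorem1 = (radical , radical-constant-term , radical-squared , λ n k → a≡b+[a-b] _ (numerN n k)) , numDispersed≡nC[n/2]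
  where
  a≡b+[a-b] : ∀ a b → a ≡ b ℤ.+ (a ℤ.- b)
  a≡b+[a-b] = ℤ-Solver.solve-∀
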